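{- Let $\Gamma$ be an abelian group, $F:\Gamma\to\Gamma$ an injective group endomorphism such that $\Gamma$ is finitely generated as a $\mathbb{Z}[F]$-module, and let $\Sigma\subseteq\Gamma$ be an $F$-spanning set with $\Sigma\cap F(\Gamma)=\{0\}$. Let $\Sigma_0\subseteq\Sigma$ be a subset containing $0$ and exactly one representative of each class modulo $F(\Gamma)$ that meets $\Sigma$. Let $g=a_0+F(a_1)+\dots+F^n(a_n)\in\Gamma\setminus\{0\}$ with all $a_i\in\Sigma$, and let $m$ be the smallest index with $a_m\neq 0$. Then $g$ has another representation of the form $$g=F^m(b_m)+F^{m+1}(b_{m+1})+\dots+F^n(b_n)+F^{n+1}(b)+F^{n+2}(b')$$ with $b_m\in\Sigma_0\setminus\{0\}$ and $b_i,b,b'\in\Sigma$ for $m\le i\le n$.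
   Context: $\mathbb{Z}[F]$-module means a $\mathbb{Z}[X]$-module structure on $\Gamma$ where $X$ acts as $F$. $\Sigma$ is a finite subset of $\Gamma$ containing $0$, symmetric ($\Sigma=-\Sigma$) and generating $\Gamma$ as a $\mathbb{Z}[F]$-module. For a word $\sigma=a_0a_1\cdots a_n\in\Sigma^*$ (finite words over $\Sigma$) write $[\sigma]_F:=a_0+F(a_1)+\dots+F^n(a_n)$. $\Sigma$ is an $F$-spanning set if: (C1) every element of $\Gamma$ equals $[\sigma]_F$ for some $\sigma\in\Sigma^*$; (C2) for all $a_1,a_2,a_3\in\Sigma$, $a_1+a_2+a_3\in\Sigma+F(\Sigma)$; (C3) if $a_1,a_2\in\Sigma$ and $a_1+a_2=F(b)$ for some $b\in\Gamma$, then $b\in\Sigma$. -}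

module Defs where

open import Level using (_⊔_)
open import Algebra.Bundles using (AbelianGroup)
open import Data.List using (List; []; _∷_)
open import Data.List.Relation.Unary.All using (All)
open import Data.List.Relation.Unary.Any using (Any)
open import Data.Nat using (ℕ; zero; suc)
open import Data.Product using (∃; _×_; _,_)

module _ {c ℓ} (G : AbelianGroup c ℓ) where
  open AbelianGroup G renaming (Carrier to Γ)

  _∈L_ : Γ → List Γ → Set (c ⊔ ℓ)
  x ∈L L = Any (x ≈_) L

  record IsInjEndo (F : Γ → Γ) : Set (c ⊔ ℓ) where
    field
      F-cong : ∀ {x y} → x ≈ y → F x ≈ F y
      F-hom  : ∀ x y → F (x ∙ y) ≈ F x ∙ F y
      F-inj  : ∀ {x y} → F x ≈ F y → x ≈ y

  iter : (Γ → Γ) → ℕ → Γ → Γ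
  iter F zero x = x
  iter F (suc k) x = F (iter F k x)

  -- [a₀ a₁ ⋯ aₙ]_F = a₀ + F(a₁) + ⋯ + Fⁿ(aₙ)
  ⟦_⟧[_] : List Γ → (Γ → Γ) → Γ
  ⟦ [] ⟧[ F ] = ε
  ⟦ a ∷ σ ⟧[ F ] = a ∙ F (⟦ σ ⟧[ F ])

  InImage : (Γ → Γ) → Γ → Set (c ⊔ ℓ)
  InImage F x = ∃ λ y → x ≈ F y

  -- the ℤ[F]-submodule generated by S: smallest subgroup containing S and closed under F
  data InSpan (F : Γ → Γ) (S : List Γ) : Γ → Set (c ⊔ ℓ) where
    sp-gen  : ∀ {x} → x ∈L S → InSpan F S x
    sp-ε    : InSpan F S ε
    sp-∙    : ∀ {x y} → InSpan F S x → InSpan F S y → InSpan F S (x ∙ y)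
    sp-⁻¹   : ∀ {x} → InSpan F S x → InSpan F S (x ⁻¹)
    sp-F    : ∀ {x} → InSpan F S x → InSpan F S (F x)
    sp-resp : ∀ {x y} → x ≈ y → InSpan F S x → InSpan F S y

  GeneratesℤF : (Γ → Γ) → List Γ → Set (c ⊔ ℓ)
  GeneratesℤF F S = ∀ x → InSpan F S x

  FinitelyGeneratedℤF : (Γ → Γ) → Set (c ⊔ ℓ)
  FinitelyGeneratedℤF F = ∃ λ (L : List Γ) → GeneratesℤF F L

  record IsFSpanning (F : Γ → Γ) (S : List Γ) : Set (c ⊔ ℓ) where
    field
      ε∈S      : ε ∈L S
      symm     : ∀ {a} → a ∈L S → (a ⁻¹) ∈L S
      generates : GeneratesℤF F S
      C1 : ∀ g → ∃ λ (σ : List Γ) → All (_∈L S) σ × g ≈ ⟦ σ ⟧[ F ]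
      C2 : ∀ {a₁ a₂ a₃} → a₁ ∈L S → a₂ ∈L S → a₃ ∈L S →
           ∃ λ b₁ → ∃ λ b₂ → b₁ ∈L S × b₂ ∈L S × (a₁ ∙ a₂) ∙ a₃ ≈ b₁ ∙ F b₂
      C3 : ∀ {a₁ a₂} b → a₁ ∈L S → a₂ ∈L S → a₁ ∙ a₂ ≈ F b → b ∈L S

  record IsRepSystem (F : Γ → Γ) (S S₀ : List Γ) : Set (c ⊔ ℓ) where
    field
      sub    : ∀ {x} → x ∈L S₀ → x ∈L S
      ε∈S₀   : ε ∈L S₀
      cover  : ∀ {a} → a ∈L S → ∃ λ r → r ∈L S₀ × InImage F (a ∙ r ⁻¹)
      unique : ∀ {r r'} → r ∈L S₀ → r' ∈L S₀ → InImage F (r ∙ r' ⁻¹) → r ≈ r'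

-- Write the nonzero digit aₘ as r + F(y) with r ∈ Σ₀: since Σ ∩ F(Γ) = {0}, r ≠ 0, and y ∈ Σ by
-- (C3) applied to aₘ + (−r) = F(y). The carry y is then pushed through the remaining digits
-- aₘ₊₁ … aₙ with (C2) (adding a digit and a carry gives a new digit and a new carry), and the
-- final carry becomes the digit b, with b′ = 0.
module Submission where

open import Defs
open import Level using (_⊔_)
open import Algebra.Bundles using (AbelianGroup)
open import Data.List using (List; []; _∷_; _++_; length)
open import Data.List.Properties using (++-assoc)
open import Data.List.Relation.Unary.All using (All; []; _∷_)
open import Data.Nat using (ℕ; zero; suc; _<_; _∸_; z≤n; s≤s)
open import Data.Fin using (Fin; toℕ)
import Data.Fin as Fin
open import Data.Vec using (Vec; lookup; toList)
import Data.Vec as Vec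
open import Data.Vec.Properties using (length-toList)
open import Data.Product using (∃; _×_; _,_)
open import Function using (_∘_)
open import Relation.Nullary using (¬_)
open import Relation.Binary.PropositionalEquality using (_≡_; cong)
import Relation.Binary.PropositionalEquality as ≡
import Algebra.Properties.Group as GroupProperties
import Relation.Binary.Reasoning.Setoid as SetoidReasoning

All-toList : ∀ {a p n} {A : Set a} {P : A → Set p} (v : Vec A n) →
             (∀ i → P (lookup v i)) → All P (toList v)
All-toList Vec.[] _ = []
All-toList (x Vec.∷ v) Pv = Pv Fin.zero ∷ All-toList v (Pv ∘ Fin.suc)

module _ {c ℓ} (G : AbelianGroup c ℓ) where
  open AbelianGroup G renaming (Carrier to Γ)
  open GroupProperties group using (identityˡ-unique; ε⁻¹≈ε)
  open SetoidReasoning setoid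

  module _ {F : Γ → Γ} (F-endo : IsInjEndo G F) where
    open IsInjEndo F-endo

    ⟦_⟧ : List Γ → Γ
    ⟦ σ ⟧ = ⟦_⟧[_] G σ F

    F-ε : F ε ≈ ε
    F-ε = identityˡ-unique (F ε) (F ε) (trans (sym (F-hom ε ε)) (F-cong (identityˡ ε)))

    iter-cong : ∀ k {x y} → x ≈ y → iter G F k x ≈ iter G F k y
    iter-cong zero    x≈y = x≈y
    iter-cong (suc k) x≈y = F-cong (iter-cong k x≈y)

    ∙-F-shift : ∀ x y z → (x ∙ F y) ∙ F z ≈ x ∙ F (y ∙ z)
    ∙-F-shift x y z = begin
      (x ∙ F y) ∙ F z  ≈⟨ assoc x (F y) (F z) ⟩
      x ∙ (F y ∙ F z)  ≈⟨ ∙-cong refl (sym (F-hom y z)) ⟩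
      x ∙ F (y ∙ z)    ∎

    ⟦⟧-++-ε : ∀ τ → ⟦ τ ++ ε ∷ [] ⟧ ≈ ⟦ τ ⟧
    ⟦⟧-++-ε []      = trans (∙-cong refl F-ε) (identityʳ ε)
    ⟦⟧-++-ε (x ∷ τ) = ∙-cong refl (F-cong (⟦⟧-++-ε τ))

    skip-leading-zeros : ∀ {p} (P : Γ → Set p) n (a : Vec Γ (suc n)) → (∀ i → P (lookup a i)) →
      (m : Fin (suc n)) → (∀ i → toℕ i < toℕ m → lookup a i ≈ ε) →
      ∃ λ σ → length σ ≡ n ∸ toℕ m × All P σ ×
        ⟦ toList a ⟧ ≈ iter G F (toℕ m) ⟦ lookup a m ∷ σ ⟧
    skip-leading-zeros P n (d Vec.∷ v) Pa Fin.zero _ =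
      toList v , length-toList v , All-toList v (Pa ∘ Fin.suc) , refl
    skip-leading-zeros P (suc n) (d Vec.∷ v) Pa (Fin.suc m) zeros
      with skip-leading-zeros P n v (Pa ∘ Fin.suc) m (λ i i<m → zeros (Fin.suc i) (s≤s i<m))
    ... | σ , len , Pσ , eq = σ , len , Pσ , (begin
      d ∙ F ⟦ toList v ⟧                           ≈⟨ ∙-cong (zeros Fin.zero (s≤s z≤n)) (F-cong eq) ⟩
      ε ∙ F (iter G F (toℕ m) ⟦ lookup v m ∷ σ ⟧)  ≈⟨ identityˡ _ ⟩
      iter G F (suc (toℕ m)) ⟦ lookup v m ∷ σ ⟧    ∎)

    module _ {S : List Γ} (spanning : IsFSpanning G F S) where
      open IsFSpanning spanning

      _∈Σ : Γ → Set (c ⊔ ℓ)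
      x ∈Σ = _∈L_ G x S

      add-digit : ∀ k σ → k ∈Σ → All _∈Σ σ →
        ∃ λ τ → ∃ λ e → length τ ≡ length σ × All _∈Σ τ × e ∈Σ × k ∙ ⟦ σ ⟧ ≈ ⟦ τ ++ e ∷ [] ⟧
      add-digit k [] k∈Σ [] = [] , k , ≡.refl , [] , k∈Σ , ∙-cong refl (sym F-ε)
      add-digit k (d ∷ σ) k∈Σ (d∈Σ ∷ σ∈Σ) with C2 k∈Σ d∈Σ ε∈S
      ... | e₀ , k′ , e₀∈Σ , k′∈Σ , k+d≈e₀+Fk′ with add-digit k′ σ k′∈Σ σ∈Σ
      ... | τ , e , len , τ∈Σ , e∈Σ , eq = e₀ ∷ τ , e , cong suc len , e₀∈Σ ∷ τ∈Σ , e∈Σ , (begin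
        k ∙ (d ∙ F ⟦ σ ⟧)      ≈⟨ sym (assoc k d _) ⟩
        (k ∙ d) ∙ F ⟦ σ ⟧      ≈⟨ ∙-cong (trans (sym (identityʳ _)) k+d≈e₀+Fk′) refl ⟩
        (e₀ ∙ F k′) ∙ F ⟦ σ ⟧  ≈⟨ ∙-F-shift e₀ k′ ⟦ σ ⟧ ⟩
        e₀ ∙ F (k′ ∙ ⟦ σ ⟧)    ≈⟨ ∙-cong refl (F-cong eq) ⟩
        e₀ ∙ F ⟦ τ ++ e ∷ [] ⟧ ∎)

      module _ (Σ∩FΓ⊆0 : ∀ a → a ∈Σ → InImage G F a → a ≈ ε)
               {S₀ : List Γ} (reps : IsRepSystem G F S S₀) where
        open IsRepSystem reps

        nonzero-digit-split : ∀ {d} → d ∈Σ → ¬ (d ≈ ε) →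
          ∃ λ r → ∃ λ y → _∈L_ G r S₀ × ¬ (r ≈ ε) × y ∈Σ × d ≈ r ∙ F y
        nonzero-digit-split {d} d∈Σ d≉ε with cover d∈Σ
        ... | r , r∈S₀ , y , d-r≈Fy =
          r , y , r∈S₀ , r≉ε , C3 y d∈Σ (symm (sub r∈S₀)) d-r≈Fy , d≈r+Fy
          where
          d≈r+Fy : d ≈ r ∙ F y
          d≈r+Fy = begin
            d               ≈⟨ sym (identityʳ d) ⟩
            d ∙ ε           ≈⟨ ∙-cong refl (sym (inverseˡ r)) ⟩
            d ∙ (r ⁻¹ ∙ r)  ≈⟨ sym (assoc d (r ⁻¹) r) ⟩
            (d ∙ r ⁻¹) ∙ r  ≈⟨ ∙-cong d-r≈Fy refl ⟩
            F y ∙ r         ≈⟨ comm (F y) r ⟩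
            r ∙ F y         ∎

          r≉ε : ¬ (r ≈ ε)
          r≉ε r≈ε = d≉ε (Σ∩FΓ⊆0 d d∈Σ (y , (begin
            d         ≈⟨ sym (identityʳ d) ⟩
            d ∙ ε     ≈⟨ ∙-cong refl (sym (trans (⁻¹-cong r≈ε) ε⁻¹≈ε)) ⟩
            d ∙ r ⁻¹  ≈⟨ d-r≈Fy ⟩
            F y       ∎)))

        normalise-leading-digit : ∀ d σ → d ∈Σ → ¬ (d ≈ ε) → All _∈Σ σ →
          ∃ λ bₘ → ∃ λ bs → ∃ λ b → ∃ λ b′ →
            _∈L_ G bₘ S₀ × ¬ (bₘ ≈ ε) × length bs ≡ length σ × All _∈Σ bs × b ∈Σ × b′ ∈Σ ×
            ⟦ d ∷ σ ⟧ ≈ ⟦ bₘ ∷ bs ++ b ∷ b′ ∷ [] ⟧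
        normalise-leading-digit d σ d∈Σ d≉ε σ∈Σ with nonzero-digit-split d∈Σ d≉ε
        ... | r , y , r∈S₀ , r≉ε , y∈Σ , d≈r+Fy with add-digit y σ y∈Σ σ∈Σ
        ... | τ , e , len , τ∈Σ , e∈Σ , eq =
          r , τ , e , ε , r∈S₀ , r≉ε , len , τ∈Σ , e∈Σ , ε∈S , (begin
            d ∙ F ⟦ σ ⟧                        ≈⟨ ∙-cong d≈r+Fy refl ⟩
            (r ∙ F y) ∙ F ⟦ σ ⟧                ≈⟨ ∙-F-shift r y ⟦ σ ⟧ ⟩
            r ∙ F (y ∙ ⟦ σ ⟧)                  ≈⟨ ∙-cong refl (F-cong eq) ⟩
            r ∙ F ⟦ τ ++ e ∷ [] ⟧              ≈⟨ ∙-cong refl (F-cong (sym (⟦⟧-++-ε (τ ++ e ∷ [])))) ⟩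
            r ∙ F ⟦ (τ ++ e ∷ []) ++ ε ∷ [] ⟧  ≡⟨ cong (λ ρ → r ∙ F ⟦ ρ ⟧) (++-assoc τ (e ∷ []) (ε ∷ [])) ⟩
            r ∙ F ⟦ τ ++ e ∷ ε ∷ [] ⟧          ∎)

lemma4p8 : ∀ {c ℓ} (G : AbelianGroup c ℓ) → let open AbelianGroup G in
    (F : Carrier → Carrier) → IsInjEndo G F → FinitelyGeneratedℤF G F →
    (S : List Carrier) → IsFSpanning G F S →
    (∀ a → _∈L_ G a S → InImage G F a → a ≈ ε) →
    (S₀ : List Carrier) → IsRepSystem G F S S₀ →
    (n : ℕ) (a : Vec Carrier (suc n)) → (∀ i → _∈L_ G (lookup a i) S) →
    ¬ (⟦_⟧[_] G (toList a) F ≈ ε) →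
    (m : Fin (suc n)) → ¬ (lookup a m ≈ ε) → (∀ i → toℕ i < toℕ m → lookup a i ≈ ε) →
    ∃ λ bₘ → ∃ λ (bs : List Carrier) → ∃ λ b → ∃ λ b' →
    _∈L_ G bₘ S₀ × ¬ (bₘ ≈ ε) × length bs ≡ n ∸ toℕ m × All (λ x → _∈L_ G x S) bs ×
    _∈L_ G b S × _∈L_ G b' S ×
    ⟦_⟧[_] G (toList a) F ≈ iter G F (toℕ m) (⟦_⟧[_] G (bₘ ∷ bs ++ b ∷ b' ∷ []) F)
lemma4p8 G F F-endo _ S spanning Σ∩FΓ⊆0 S₀ reps n a a∈Σ _ m aₘ≉ε zeros
  with skip-leading-zeros G F-endo (λ x → _∈L_ G x S) n a a∈Σ m zeros
... | σ , len , σ∈Σ , a≈Fᵐ[aₘσ]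
  with normalise-leading-digit G F-endo spanning Σ∩FΓ⊆0 reps (lookup a m) σ (a∈Σ m) aₘ≉ε σ∈Σ
... | bₘ , bs , b , b′ , bₘ∈S₀ , bₘ≉ε , len′ , bs∈Σ , b∈Σ , b′∈Σ , aₘσ≈bₘbsbb′ =
  bₘ , bs , b , b′ , bₘ∈S₀ , bₘ≉ε , ≡.trans len′ len , bs∈Σ , b∈Σ , b′∈Σ ,
  AbelianGroup.trans G a≈Fᵐ[aₘσ] (iter-cong G F-endo (toℕ m) aₘσ≈bₘbsbb′)
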